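{- Let $G$ be a finite simple graph with at least one vertex and let $\kappa:V(G)\to\mathbb{N}\cup\{0\}$. (i) If $G$ is $\kappa$-degenerate and $|E(G)|=\sum_{v\in V(G)}\kappa(v)$, then there exists a vertex $v$ of $G$ with $\deg_G(v)=\kappa(v)$. (ii) If $v$ is a vertex of $G$ with $\deg_G(v)=\kappa(v)$, then $G$ is $\kappa$-degenerate if and only if $G\setminus\{v\}$ is $\kappa'$-degenerate, where $\kappa'$ is the restriction of $\kappa$ to $V(G)\setminus\{v\}$.
   Context: For a graph $H$ and a function $\kappa: V(H)\to\mathbb{N}\cup\{0\}$, $H$ is called $\kappa$-degenerate if its vertices can be ordered $v_1,\dots,v_h$ so that for every $i$, the degree of $v_i$ in the subgraph of $H$ induced by $\{v_1,\dots,v_i\}$ is at most $\kappa(v_i)$. -}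

module Defs where

open import Data.Nat using (ℕ; zero; suc; _+_; _≤_; _<ᵇ_)
open import Data.Bool using (Bool; true; false; if_then_else_; _∧_)
open import Data.Fin using (Fin; zero; suc; toℕ; punchIn)
open import Data.Fin.Permutation using (Permutation′; _⟨$⟩ʳ_)
open import Data.Product using (∃)
open import Relation.Binary.PropositionalEquality using (_≡_)

record Graph (n : ℕ) : Set where
  field
    adj    : Fin n → Fin n → Bool
    sym    : ∀ i j → adj i j ≡ adj j i
    irrefl : ∀ i → adj i i ≡ false
open Graph public

sumF : ∀ {n} → (Fin n → ℕ) → ℕ
sumF {zero}  f = 0
sumF {suc n} f = f zero + sumF (λ i → f (suc i))

countB : ∀ {n} → (Fin n → Bool) → ℕ
countB p = sumF (λ i → if p i then 1 else 0)

deg : ∀ {n} → Graph n → Fin n → ℕ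
deg G v = countB (adj G v)

edges : ∀ {n} → Graph n → ℕ
edges G = sumF (λ i → countB (λ j → adj G i j ∧ (toℕ i <ᵇ toℕ j)))

-- κ-degenerate: there is an ordering v_1..v_n of the vertices (a permutation
-- σ, v_i = σ i) such that the degree of σ i in the subgraph induced by
-- {σ j | j ≤ i} — i.e. the number of neighbours σ j with j < i — is ≤ κ (σ i).
Degenerate : ∀ {n} → Graph n → (Fin n → ℕ) → Set
Degenerate {n} G κ =
  ∃ λ (σ : Permutation′ n) → ∀ (i : Fin n) →
    countB (λ j → adj G (σ ⟨$⟩ʳ i) (σ ⟨$⟩ʳ j) ∧ (toℕ j <ᵇ toℕ i)) ≤ κ (σ ⟨$⟩ʳ i)

deleteV : ∀ {n} → Graph (suc n) → Fin (suc n) → Graph n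
deleteV G v = record
  { adj    = λ i j → adj G (punchIn v i) (punchIn v j)
  ; sym    = λ i j → sym G (punchIn v i) (punchIn v j)
  ; irrefl = λ i → irrefl G (punchIn v i)
  }

-- The back-degrees along any ordering of the vertices sum to the number of
-- edges, since every edge is counted once, at its later endpoint. Hence if
-- the back-degrees are bounded by κ and ∑ κ equals the number of edges, every
-- bound is attained, in particular at the last vertex, whose back-degree is
-- its full degree. For (ii), deleting a vertex from an ordering can only lower
-- back-degrees, and conversely a vertex with deg = κ may be appended at the end.
module Submission where

open import Defs hiding (sym)
open import Data.Nat using (ℕ; zero; suc; _+_; _*_; _≤_; _<ᵇ_; z≤n)
open import Data.Nat.Properties
  using (+-0-commutativeMonoid; +-identityʳ; *-cancelˡ-≡; ≤-antisym; ≤-trans; ≤-reflexive;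
         +-mono-≤; +-monoˡ-≤; +-monoʳ-≤; +-cancelˡ-≤; +-cancelʳ-≤; m≤n+m; module ≤-Reasoning)
open import Data.Bool using (Bool; true; false; if_then_else_; _∧_)
open import Data.Bool.Properties using (∧-identityʳ; ∧-zeroʳ)
open import Data.Fin using (Fin; zero; suc; toℕ; fromℕ; punchIn; punchOut; _≟_)
open import Data.Fin.Properties using (toℕ-injective; punchIn-punchOut)
open import Data.Fin.Permutation as Perm using (Permutation′; _⟨$⟩ʳ_; _⟨$⟩ˡ_)
open import Data.Product using (_×_; _,_; ∃)
open import Function using (_∘_)
open import Function.Bundles using (_⇔_; mk⇔)
open import Function.Definitions using (Injective)
open import Relation.Binary.PropositionalEquality
  using (_≡_; _≢_; _≗_; refl; sym; trans; cong; cong₂; subst; module ≡-Reasoning)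
open import Relation.Nullary using (yes; no)
open import Relation.Nullary.Negation using (contradiction)
import Algebra.Properties.CommutativeMonoid.Sum as Sum

module Σ = Sum +-0-commutativeMonoid

𝟙 : Bool → ℕ
𝟙 b = if b then 1 else 0

+-self-injective : ∀ {a b} → a + a ≡ b + b → a ≡ b
+-self-injective {a} {b} eq = *-cancelˡ-≡ a b 2 (begin
  2 * a   ≡⟨ cong (a +_) (+-identityʳ a) ⟩
  a + a   ≡⟨ eq ⟩
  b + b   ≡⟨ cong (b +_) (+-identityʳ b) ⟨
  2 * b   ∎)
  where open ≡-Reasoning

sumF≗sum : ∀ {n} (f : Fin n → ℕ) → sumF f ≡ Σ.sum f
sumF≗sum {zero}  f = refl
sumF≗sum {suc n} f = cong (f zero +_) (sumF≗sum (f ∘ suc))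

module _ {n : ℕ} where

  sumF-cong : {f g : Fin n → ℕ} → f ≗ g → sumF f ≡ sumF g
  sumF-cong {f} {g} f≗g =
    trans (sumF≗sum f) (trans (Σ.sum-cong-≗ f≗g) (sym (sumF≗sum g)))

  sumF-permute : (π : Permutation′ n) (f : Fin n → ℕ) → sumF f ≡ sumF (f ∘ (π ⟨$⟩ʳ_))
  sumF-permute π f =
    trans (sumF≗sum f) (trans (Σ.sum-permute f π) (sym (sumF≗sum (f ∘ (π ⟨$⟩ʳ_)))))

  sumF-distrib-+ : (f g : Fin n → ℕ) → sumF (λ i → f i + g i) ≡ sumF f + sumF g
  sumF-distrib-+ f g = trans (sumF≗sum (λ i → f i + g i))
    (trans (Σ.∑-distrib-+ f g) (sym (cong₂ _+_ (sumF≗sum f) (sumF≗sum g))))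

  sumF-comm : ∀ {m} (f : Fin n → Fin m → ℕ) →
              sumF (λ i → sumF (f i)) ≡ sumF (λ j → sumF (λ i → f i j))
  sumF-comm f = begin
    sumF (λ i → sumF (f i))         ≡⟨ sumF≗sum (λ i → sumF (f i)) ⟩
    Σ.sum (λ i → sumF (f i))        ≡⟨ Σ.sum-cong-≗ (λ i → sumF≗sum (f i)) ⟩
    Σ.sum (λ i → Σ.sum (f i))       ≡⟨ Σ.∑-comm f ⟩
    Σ.sum (λ j → Σ.sum (λ i → f i j)) ≡⟨ Σ.sum-cong-≗ (λ j → sumF≗sum (λ i → f i j)) ⟨
    Σ.sum (λ j → sumF (λ i → f i j))  ≡⟨ sumF≗sum (λ j → sumF (λ i → f i j)) ⟨
    sumF (λ j → sumF (λ i → f i j)) ∎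
    where open ≡-Reasoning

sumF-remove : ∀ {n} (p : Fin (suc n)) (f : Fin (suc n) → ℕ) → sumF f ≡ f p + sumF (f ∘ punchIn p)
sumF-remove p f = trans (sumF≗sum f)
  (trans (Σ.sum-remove {i = p} f) (cong (f p +_) (sym (sumF≗sum (f ∘ punchIn p)))))

sumF-mono : ∀ {n} {f g : Fin n → ℕ} → (∀ i → f i ≤ g i) → sumF f ≤ sumF g
sumF-mono {zero}  f≤g = z≤n
sumF-mono {suc n} f≤g = +-mono-≤ (f≤g zero) (sumF-mono (f≤g ∘ suc))

sumF-tight : ∀ {n} {f g : Fin n → ℕ} → (∀ i → f i ≤ g i) → sumF g ≤ sumF f → f ≗ g
sumF-tight {suc n} {f} {g} f≤g g≤f zero = ≤-antisym (f≤g zero)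
  (+-cancelʳ-≤ (sumF (g ∘ suc)) (g zero) (f zero)
    (≤-trans g≤f (+-monoʳ-≤ (f zero) (sumF-mono (f≤g ∘ suc)))))
sumF-tight {suc n} {f} {g} f≤g g≤f (suc i) = sumF-tight (f≤g ∘ suc)
  (+-cancelˡ-≤ (g zero) _ _ (≤-trans g≤f (+-monoˡ-≤ (sumF (f ∘ suc)) (f≤g zero)))) i

𝟙-<ᵇ+𝟙->ᵇ : ∀ a b → a ≢ b → 𝟙 (b <ᵇ a) + 𝟙 (a <ᵇ b) ≡ 1
𝟙-<ᵇ+𝟙->ᵇ zero    zero    a≢b = contradiction refl a≢b
𝟙-<ᵇ+𝟙->ᵇ zero    (suc b) a≢b = refl
𝟙-<ᵇ+𝟙->ᵇ (suc a) zero    a≢b = refl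
𝟙-<ᵇ+𝟙->ᵇ (suc a) (suc b) a≢b = 𝟙-<ᵇ+𝟙->ᵇ a b (a≢b ∘ cong suc)

punchIn-<ᵇ : ∀ {n} (p : Fin (suc n)) (j k : Fin n) →
             (toℕ (punchIn p j) <ᵇ toℕ (punchIn p k)) ≡ (toℕ j <ᵇ toℕ k)
punchIn-<ᵇ zero    j       k       = refl
punchIn-<ᵇ (suc p) zero    zero    = refl
punchIn-<ᵇ (suc p) zero    (suc k) = refl
punchIn-<ᵇ (suc p) (suc j) zero    = refl
punchIn-<ᵇ (suc p) (suc j) (suc k) = punchIn-<ᵇ p j k

<ᵇ-fromℕ : ∀ {n} (j : Fin (suc n)) → j ≢ fromℕ n → (toℕ j <ᵇ toℕ (fromℕ n)) ≡ true
<ᵇ-fromℕ {zero}  zero    j≢n = contradiction refl j≢n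
<ᵇ-fromℕ {suc n} zero    j≢n = refl
<ᵇ-fromℕ {suc n} (suc j) j≢n = <ᵇ-fromℕ j (j≢n ∘ cong suc)

fromℕ-≮ᵇ-punchIn : ∀ {n} (k : Fin n) → (toℕ (fromℕ n) <ᵇ toℕ (punchIn (fromℕ n) k)) ≡ false
fromℕ-≮ᵇ-punchIn zero    = refl
fromℕ-≮ᵇ-punchIn (suc k) = fromℕ-≮ᵇ-punchIn k

module _ {n : ℕ} (G : Graph n) where

  lowerDeg upperDeg : (Fin n → ℕ) → Fin n → ℕ
  lowerDeg r i = countB (λ j → adj G i j ∧ (r j <ᵇ r i))
  upperDeg r i = countB (λ j → adj G i j ∧ (r i <ᵇ r j))

  sumF-lowerDeg≡sumF-upperDeg : ∀ r → sumF (lowerDeg r) ≡ sumF (upperDeg r)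
  sumF-lowerDeg≡sumF-upperDeg r = trans (sumF-comm (λ i j → 𝟙 (adj G i j ∧ (r j <ᵇ r i))))
    (sumF-cong λ i → sumF-cong λ j → cong (λ b → 𝟙 (b ∧ (r i <ᵇ r j))) (Graph.sym G j i))

  lowerDeg+upperDeg≡deg : ∀ {r} → Injective _≡_ _≡_ r → ∀ i → lowerDeg r i + upperDeg r i ≡ deg G i
  lowerDeg+upperDeg≡deg {r} r-inj i =
    trans (sym (sumF-distrib-+ (λ j → 𝟙 (adj G i j ∧ (r j <ᵇ r i))) (λ j → 𝟙 (adj G i j ∧ (r i <ᵇ r j)))))
          (sumF-cong split)
    where
    split : ∀ j → 𝟙 (adj G i j ∧ (r j <ᵇ r i)) + 𝟙 (adj G i j ∧ (r i <ᵇ r j)) ≡ 𝟙 (adj G i j)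
    split j with adj G i j in i~j
    ... | false = refl
    ... | true  = 𝟙-<ᵇ+𝟙->ᵇ (r i) (r j) λ rᵢ≡rⱼ → loop (r-inj rᵢ≡rⱼ)
      where
      loop : i ≢ j
      loop refl with trans (sym i~j) (irrefl G i)
      ... | ()

  handshake-lowerDeg : ∀ {r} → Injective _≡_ _≡_ r →
                       sumF (lowerDeg r) + sumF (lowerDeg r) ≡ sumF (deg G)
  handshake-lowerDeg {r} r-inj = begin
    sumF (lowerDeg r) + sumF (lowerDeg r)       ≡⟨ cong (sumF (lowerDeg r) +_) (sumF-lowerDeg≡sumF-upperDeg r) ⟩
    sumF (lowerDeg r) + sumF (upperDeg r)       ≡⟨ sumF-distrib-+ (lowerDeg r) (upperDeg r) ⟨
    sumF (λ i → lowerDeg r i + upperDeg r i)    ≡⟨ sumF-cong (lowerDeg+upperDeg≡deg r-inj) ⟩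
    sumF (deg G)                                ∎
    where open ≡-Reasoning

  -- edges G is ∑ upperDeg toℕ, and both sides are half of ∑ deg G.
  edges≡sumF-lowerDeg : ∀ {r} → Injective _≡_ _≡_ r → edges G ≡ sumF (lowerDeg r)
  edges≡sumF-lowerDeg r-inj = trans (sym (sumF-lowerDeg≡sumF-upperDeg toℕ))
    (+-self-injective (trans (handshake-lowerDeg toℕ-injective) (sym (handshake-lowerDeg r-inj))))

rank : ∀ {n} → Permutation′ n → Fin n → ℕ
rank σ v = toℕ (σ ⟨$⟩ˡ v)

rank-injective : ∀ {n} (σ : Permutation′ n) → Injective _≡_ _≡_ (rank σ)
rank-injective σ {u} {v} eq = begin
  u                          ≡⟨ Perm.inverseʳ σ ⟨
  σ ⟨$⟩ʳ (σ ⟨$⟩ˡ u)          ≡⟨ cong (σ ⟨$⟩ʳ_) (toℕ-injective eq) ⟩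
  σ ⟨$⟩ʳ (σ ⟨$⟩ˡ v)          ≡⟨ Perm.inverseʳ σ ⟩
  v                          ∎
  where open ≡-Reasoning

module _ {n : ℕ} (G : Graph n) where

  backDeg : Permutation′ n → Fin n → ℕ
  backDeg σ i = countB (λ j → adj G (σ ⟨$⟩ʳ i) (σ ⟨$⟩ʳ j) ∧ (toℕ j <ᵇ toℕ i))

  backDeg≡lowerDeg-rank : ∀ σ i → backDeg σ i ≡ lowerDeg G (rank σ) (σ ⟨$⟩ʳ i)
  backDeg≡lowerDeg-rank σ i = sym (trans
    (sumF-permute σ (λ c → 𝟙 (adj G (σ ⟨$⟩ʳ i) c ∧ (rank σ c <ᵇ rank σ (σ ⟨$⟩ʳ i)))))
    (sumF-cong λ j → cong₂ (λ a b → 𝟙 (adj G (σ ⟨$⟩ʳ i) (σ ⟨$⟩ʳ j) ∧ (toℕ a <ᵇ toℕ b)))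
                           (Perm.inverseˡ σ) (Perm.inverseˡ σ)))

  sumF-backDeg≡edges : ∀ σ → sumF (backDeg σ) ≡ edges G
  sumF-backDeg≡edges σ = begin
    sumF (backDeg σ)                                ≡⟨ sumF-cong (backDeg≡lowerDeg-rank σ) ⟩
    sumF (lowerDeg G (rank σ) ∘ (σ ⟨$⟩ʳ_))          ≡⟨ sumF-permute σ (lowerDeg G (rank σ)) ⟨
    sumF (lowerDeg G (rank σ))                      ≡⟨ edges≡sumF-lowerDeg G (rank-injective σ) ⟨
    edges G                                         ∎
    where open ≡-Reasoning

module _ {n : ℕ} (G : Graph (suc n)) where

  backDeg-last : ∀ σ → backDeg G σ (fromℕ n) ≡ deg G (σ ⟨$⟩ʳ fromℕ n)
  backDeg-last σ = sym (trans (sumF-permute σ (𝟙 ∘ adj G (σ ⟨$⟩ʳ fromℕ n)))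
                              (sumF-cong (cong 𝟙 ∘ all-earlier)))
    where
    all-earlier : ∀ j → adj G (σ ⟨$⟩ʳ fromℕ n) (σ ⟨$⟩ʳ j)
                      ≡ (adj G (σ ⟨$⟩ʳ fromℕ n) (σ ⟨$⟩ʳ j) ∧ (toℕ j <ᵇ toℕ (fromℕ n)))
    all-earlier j with j ≟ fromℕ n
    ... | yes refl = trans (irrefl G _) (cong (_∧ _) (sym (irrefl G _)))
    ... | no  j≢n  = sym (trans (cong (adj G (σ ⟨$⟩ʳ fromℕ n) (σ ⟨$⟩ʳ j) ∧_) (<ᵇ-fromℕ j j≢n))
                                (∧-identityʳ _))

  -- The hypothesis says that deleting position p from the ordering σ of G
  -- leaves the ordering τ of G ∖ {v}.
  backDeg-punchIn : ∀ σ (τ : Permutation′ n) p v →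
    (∀ x → σ ⟨$⟩ʳ punchIn p x ≡ punchIn v (τ ⟨$⟩ʳ x)) → ∀ k →
    backDeg G σ (punchIn p k)
      ≡ 𝟙 (adj G (σ ⟨$⟩ʳ punchIn p k) (σ ⟨$⟩ʳ p) ∧ (toℕ p <ᵇ toℕ (punchIn p k)))
        + backDeg (deleteV G v) τ k
  backDeg-punchIn σ τ p v σ∘p≡v∘τ k = trans
    (sumF-remove p (λ j → 𝟙 (adj G (σ ⟨$⟩ʳ punchIn p k) (σ ⟨$⟩ʳ j) ∧ (toℕ j <ᵇ toℕ (punchIn p k)))))
    (cong (_ +_) (sumF-cong λ j → cong 𝟙
      (cong₂ _∧_ (cong₂ (adj G) (σ∘p≡v∘τ k) (σ∘p≡v∘τ j)) (punchIn-<ᵇ p j k))))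

insert-pivot : ∀ {m n} (i : Fin (suc m)) (j : Fin (suc n)) (π : Perm.Permutation m n) →
               Perm.insert i j π ⟨$⟩ʳ i ≡ j
insert-pivot i j π with i ≟ i
... | yes _   = refl
... | no  i≢i = contradiction refl i≢i

module _ {n : ℕ} (G : Graph (suc n)) (κ : Fin (suc n) → ℕ) where

  Degenerate-deleteV⁺ : ∀ v → Degenerate G κ → Degenerate (deleteV G v) (κ ∘ punchIn v)
  Degenerate-deleteV⁺ v (σ , backDeg≤κ) = τ , λ k → begin
    backDeg (deleteV G v) τ k            ≤⟨ m≤n+m _ _ ⟩
    _ + backDeg (deleteV G v) τ k        ≡⟨ backDeg-punchIn G σ τ p v σ∘p≡v∘τ k ⟨
    backDeg G σ (punchIn p k)            ≤⟨ backDeg≤κ (punchIn p k) ⟩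
    κ (σ ⟨$⟩ʳ punchIn p k)               ≡⟨ cong κ (σ∘p≡v∘τ k) ⟩
    κ (punchIn v (τ ⟨$⟩ʳ k))             ∎
    where
    open ≤-Reasoning
    p = σ ⟨$⟩ˡ v
    τ = Perm.remove p σ
    σ∘p≡v∘τ : ∀ x → σ ⟨$⟩ʳ punchIn p x ≡ punchIn v (τ ⟨$⟩ʳ x)
    σ∘p≡v∘τ = Perm.punchIn-permute′ σ v

  Degenerate-deleteV⁻ : ∀ v → deg G v ≡ κ v →
                        Degenerate (deleteV G v) (κ ∘ punchIn v) → Degenerate G κ
  Degenerate-deleteV⁻ v degv≡κv (τ , backDeg≤κ) = σ , bound
    where
    last = fromℕ n
    σ = Perm.insert last v τ
    σ∘last≡v∘τ : ∀ x → σ ⟨$⟩ʳ punchIn last x ≡ punchIn v (τ ⟨$⟩ʳ x)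
    σ∘last≡v∘τ = Perm.insert-punchIn last v τ
    bound-earlier : ∀ k → backDeg G σ (punchIn last k) ≤ κ (σ ⟨$⟩ʳ punchIn last k)
    bound-earlier k = begin
      backDeg G σ (punchIn last k)     ≡⟨ backDeg-punchIn G σ τ last v σ∘last≡v∘τ k ⟩
      𝟙 (k~last ∧ (toℕ last <ᵇ toℕ (punchIn last k))) + backDeg (deleteV G v) τ k
                                       ≡⟨ cong (λ b → 𝟙 b + backDeg (deleteV G v) τ k)
                                               (trans (cong (k~last ∧_) (fromℕ-≮ᵇ-punchIn k)) (∧-zeroʳ k~last)) ⟩
      backDeg (deleteV G v) τ k        ≤⟨ backDeg≤κ k ⟩
      κ (punchIn v (τ ⟨$⟩ʳ k))         ≡⟨ cong κ (σ∘last≡v∘τ k) ⟨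
      κ (σ ⟨$⟩ʳ punchIn last k)        ∎
      where
      open ≤-Reasoning
      k~last = adj G (σ ⟨$⟩ʳ punchIn last k) (σ ⟨$⟩ʳ last)
    bound : ∀ i → backDeg G σ i ≤ κ (σ ⟨$⟩ʳ i)
    bound i with i ≟ last
    ... | yes refl = ≤-reflexive (trans (backDeg-last G σ)
                       (subst (λ u → deg G u ≡ κ u) (sym (insert-pivot last v τ)) degv≡κv))
    ... | no  i≢last = subst (λ j → backDeg G σ j ≤ κ (σ ⟨$⟩ʳ j))
                         (punchIn-punchOut (i≢last ∘ sym)) (bound-earlier (punchOut (i≢last ∘ sym)))

  Degenerate∧edges≡sumF⇒deg≡κ : Degenerate G κ → edges G ≡ sumF κ → ∃ λ v → deg G v ≡ κ v
  Degenerate∧edges≡sumF⇒deg≡κ (σ , backDeg≤κ) edges≡∑κ =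
    σ ⟨$⟩ʳ fromℕ n , trans (sym (backDeg-last G σ)) (sumF-tight backDeg≤κ ∑κ≤∑backDeg (fromℕ n))
    where
    ∑κ≤∑backDeg : sumF (κ ∘ (σ ⟨$⟩ʳ_)) ≤ sumF (backDeg G σ)
    ∑κ≤∑backDeg = ≤-reflexive (trans (sym (sumF-permute σ κ))
                    (trans (sym edges≡∑κ) (sym (sumF-backDeg≡edges G σ))))

proposition1 : ∀ (n : ℕ) (G : Graph (suc n)) (κ : Fin (suc n) → ℕ) →
    ((Degenerate G κ → edges G ≡ sumF κ → ∃ λ v → deg G v ≡ κ v)
    × (∀ (v : Fin (suc n)) → deg G v ≡ κ v →
    (Degenerate G κ ⇔ Degenerate (deleteV G v) (κ ∘ punchIn v))))
proposition1 n G κ =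
  Degenerate∧edges≡sumF⇒deg≡κ G κ ,
  λ v degv≡κv → mk⇔ (Degenerate-deleteV⁺ G κ v) (Degenerate-deleteV⁻ G κ v degv≡κv)
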